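{- Let $(K,\oplus,\otimes,\hat 0,\hat 1)$ be a commutative and idempotent semiring, $P$ a finite nonempty set of ports with weights $k_p\in K$ ($p\in P$), and let $z$ be a term of the weighted Algebra of Interactions $wAI(P)$ over $P$ and $K$. Then for every $\gamma\in\Gamma(P)$, $$\bigoplus_{a\in\gamma}\|z\|(\{a\})=\|z\|(\gamma).$$
   Context: $(K,\oplus,\otimes,\hat0,\hat1)$ is a commutative semiring that is additively idempotent ($k\oplus k=k$ for all $k$). $P$ is a finite nonempty set of ports with $0,1\notin P$, and each $p\in P$ carries a fixed weight $k_p\in K$. $\Gamma(P)=2^{2^P}$ is the set of all sets of subsets of $P$ (a member $\gamma$ may contain the empty set, and $\gamma$ may itself be empty). The terms of $wAI(P)$ are generated by $z::=0\mid 1\mid p\mid z\oplus z\mid z\otimes z\mid (z)$ with $p\in P$ (here $0,1$ are formal symbols distinct from $\hat0,\hat1$). The semantics assigns to each term $z$ and each $\gamma\in\Gamma(P)$ a value $\|z\|(\gamma)\in K$ inductively: $\|0\|(\gamma)=\hat0$; $\|1\|(\gamma)=\hat1$ if $\emptyset\in\gamma$ and $\hat0$ otherwise; $\|p\|(\gamma)=k_p$ if some $a\in\gamma$ has $p\in a$, and $\hat0$ otherwise; $\|z_1\oplus z_2\|(\gamma)=\bigoplus_{a\in\gamma}\big(\|z_1\|(\{a\})\oplus\|z_2\|(\{a\})\big)$; $\|z_1\otimes z_2\|(\gamma)=\bigoplus_{a\in\gamma}\bigoplus_{a=a_1\cup a_2}\big(\|z_1\|(\{a_1\})\otimes\|z_2\|(\{a_2\})\big)$,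 where the inner sum ranges over all pairs $(a_1,a_2)$ of (possibly empty) subsets of $P$ with $a_1\cup a_2=a$; $\|(z)\|(\gamma)=\|z\|(\gamma)$. Empty sums equal $\hat0$. -}

module Defs where

open import Level using (Level)
open import Data.Nat using (ℕ; zero; suc)
open import Data.Bool using (Bool; true; false; if_then_else_)
open import Data.Fin using (Fin)
open import Data.Vec using (Vec; []; _∷_; lookup)
open import Data.List using (List; []; _∷_; map; _++_; foldr; concatMap)
open import Data.Fin.Subset using (Subset; Side; inside; outside; _∪_)
open import Relation.Nullary using (does)
open import Data.Vec.Properties using (≡-dec)
open import Data.Bool.Properties using () renaming (_≟_ to _≟ᵇ_)
open import Algebra.Bundles using (CommutativeSemiring)

-- Ports are Fin n (n ≥ 1 is imposed in the statement); a subset of ports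
-- is a  Subset n  (a Vec Bool n).

allSubsets : (n : ℕ) → List (Subset n)
allSubsets zero = [] ∷ []
allSubsets (suc n) =
  map (inside ∷_) (allSubsets n) ++ map (outside ∷_) (allSubsets n)

_≟ˢ_ : {n : ℕ} → (a b : Subset n) → Bool
a ≟ˢ b = does (≡-dec _≟ᵇ_ a b)

-- Γ(P) = 2^(2^P): a set of subsets of P, given by its (decidable)
-- characteristic function.
Γ : ℕ → Set
Γ n = Subset n → Bool

⟦_⟧ : {n : ℕ} → Subset n → Γ n
⟦ a ⟧ b = b ≟ˢ a

data Term (n : ℕ) : Set where
  𝟘   : Term n
  𝟙   : Term n
  port : Fin n → Term n
  _⊕_ : Term n → Term n → Term n
  _⊗_ : Term n → Term n → Term n
-- (parentheses (z) are syntactic grouping; ‖(z)‖ = ‖z‖, so no constructor)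

module Semantics {c ℓ : Level} (S : CommutativeSemiring c ℓ) where
  open CommutativeSemiring S renaming (Carrier to K; _+_ to _⊕ᴷ_; _*_ to _⊗ᴷ_; 0# to 0̂; 1# to 1̂)

  ⨁ : List K → K
  ⨁ = foldr _⊕ᴷ_ 0̂

  sumOver : {n : ℕ} → Γ n → (Subset n → K) → K
  sumOver {n} γ f = ⨁ (map (λ a → if γ a then f a else 0̂) (allSubsets n))

  anyIn : {n : ℕ} → Γ n → (Subset n → Bool) → Bool
  anyIn {n} γ t = foldr (λ a r → if γ a then (if t a then true else r) else r) false (allSubsets n)

  sumSplits : {n : ℕ} → Subset n → (Subset n → Subset n → K) → K
  sumSplits {n} a f =
    ⨁ (concatMap (λ a₁ → map (λ a₂ → if (a₁ ∪ a₂) ≟ˢ a then f a₁ a₂ else 0̂) (allSubsets n))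
                 (allSubsets n))

  ‖_‖ : {n : ℕ} → Term n → (k : Fin n → K) → Γ n → K
  ‖ 𝟘 ‖ k γ = 0̂
  ‖ 𝟙 ‖ k γ = if γ (Data.Vec.replicate _ outside) then 1̂ else 0̂
  ‖ port p ‖ k γ = if anyIn γ (λ a → lookup a p) then k p else 0̂
  ‖ z₁ ⊕ z₂ ‖ k γ = sumOver γ (λ a → ‖ z₁ ‖ k ⟦ a ⟧ ⊕ᴷ ‖ z₂ ‖ k ⟦ a ⟧)
  ‖ z₁ ⊗ z₂ ‖ k γ = sumOver γ (λ a → sumSplits a (λ a₁ a₂ → ‖ z₁ ‖ k ⟦ a₁ ⟧ ⊗ᴷ ‖ z₂ ‖ k ⟦ a₂ ⟧))

{-# OPTIONS --safe #-}
-- Every semantics is "pointwise": ‖ z ‖ γ is the ⊕-sum over a ∈ γ of a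
-- density d_z(a) that does not depend on γ. For ⊕ and ⊗ this is the
-- definition; for 𝟙 and the ports it holds because an idempotent sum of
-- copies of one value (and zeros) is that value. Summing over a singleton
-- {a} picks out d_z(a), so both sides of the theorem equal ⨁_{a ∈ γ} d_z(a).
module Submission where

open import Defs
open import Level using (Level)
open import Data.Nat using (ℕ; suc)
open import Data.Fin using (Fin)
open import Algebra.Bundles using (CommutativeSemiring)
open import Data.Bool using (Bool; true; false; if_then_else_)
open import Data.Vec using ([]; _∷_; lookup; replicate)
open import Data.Fin.Subset using (Subset; inside; outside)
open import Data.List using ([]; _∷_; map; foldr)
open import Data.List.Membership.Propositional using (_∈_; lose)
open import Data.List.Membership.Propositional.Properties using (∈-++⁺ˡ; ∈-++⁺ʳ; ∈-map⁺)
open import Data.List.Relation.Unary.All as All using (All; []; _∷_)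
open import Data.List.Relation.Unary.All.Properties as All using ()
open import Data.List.Relation.Unary.Any using (Any; here; there)
open import Data.List.Relation.Unary.Any.Properties as Any using ()
open import Data.Sum using (_⊎_; inj₁; inj₂)
open import Data.Vec.Properties using (≡-dec)
open import Data.Bool.Properties using () renaming (_≟_ to _≟ᵇ_)
open import Relation.Nullary using (yes; no)
open import Relation.Nullary.Decidable using (dec-true; dec-false)
open import Relation.Binary.PropositionalEquality as ≡ using (_≡_; _≢_)

∈-allSubsets : ∀ {n} (a : Subset n) → a ∈ allSubsets n
∈-allSubsets [] = here ≡.refl
∈-allSubsets {suc n} (inside ∷ a) = ∈-++⁺ˡ (∈-map⁺ (inside ∷_) (∈-allSubsets a))
∈-allSubsets {suc n} (outside ∷ a) =
  ∈-++⁺ʳ (map (inside ∷_) (allSubsets n)) (∈-map⁺ (outside ∷_) (∈-allSubsets a))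

≟ˢ-refl : ∀ {n} (a : Subset n) → a ≟ˢ a ≡ true
≟ˢ-refl a = dec-true (≡-dec _≟ᵇ_ a a) ≡.refl

≟ˢ-≢ : ∀ {n} {a b : Subset n} → a ≢ b → a ≟ˢ b ≡ false
≟ˢ-≢ {a = a} {b} a≢b = dec-false (≡-dec _≟ᵇ_ a b) a≢b

module _ {c ℓ : Level} (S : CommutativeSemiring c ℓ) where
  open CommutativeSemiring S renaming (Carrier to K)
  open Semantics S
  open import Relation.Binary.Reasoning.Setoid setoid

  ZeroOr : K → K → Set ℓ
  ZeroOr v x = x ≈ 0# ⊎ x ≈ v

  if-ZeroOr : ∀ b x → ZeroOr x (if b then x else 0#)
  if-ZeroOr true x = inj₂ refl
  if-ZeroOr false x = inj₁ refl

  if-false : ∀ {b} x → b ≡ false → (if b then x else 0#) ≈ 0#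
  if-false x ≡.refl = refl

  if-0# : ∀ b → (if b then 0# else 0#) ≈ 0#
  if-0# true = refl
  if-0# false = refl

  ⨁-cong : ∀ {A : Set} {f g : A → K} → (∀ a → f a ≈ g a) →
           ∀ xs → ⨁ (map f xs) ≈ ⨁ (map g xs)
  ⨁-cong f≈g [] = refl
  ⨁-cong f≈g (a ∷ xs) = +-cong (f≈g a) (⨁-cong f≈g xs)

  sumOver-cong : ∀ {n} (γ : Γ n) {f g : Subset n → K} → (∀ a → f a ≈ g a) →
                 sumOver γ f ≈ sumOver γ g
  sumOver-cong {n} γ {f} {g} f≈g = ⨁-cong guarded (allSubsets n)
    where
    guarded : ∀ a → (if γ a then f a else 0#) ≈ (if γ a then g a else 0#)
    guarded a with γ a
    ... | true = f≈g a
    ... | false = refl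

  density : ∀ {n} → Term n → (Fin n → K) → Subset n → K
  density 𝟘          k a = 0#
  density 𝟙          k a = if ⟦ replicate _ outside ⟧ a then 1# else 0#
  density (port p)   k a = if lookup a p then k p else 0#
  density (z₁ ⊕ z₂) k a = ‖ z₁ ‖ k ⟦ a ⟧ + ‖ z₂ ‖ k ⟦ a ⟧
  density (z₁ ⊗ z₂) k a = sumSplits a (λ a₁ a₂ → ‖ z₁ ‖ k ⟦ a₁ ⟧ * ‖ z₂ ‖ k ⟦ a₂ ⟧)

  module Idempotent (+-idem : ∀ x → x + x ≈ x) where

    +-absorbs-ZeroOr : ∀ {v x} → ZeroOr v x → v + x ≈ v
    +-absorbs-ZeroOr {v} (inj₁ x≈0) = trans (+-congˡ x≈0) (+-identityʳ v)
    +-absorbs-ZeroOr {v} (inj₂ x≈v) = trans (+-congˡ x≈v) (+-idem v)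

    +-⨁-absorbs : ∀ {v xs} → All (ZeroOr v) xs → v + ⨁ xs ≈ v
    +-⨁-absorbs {v} [] = +-identityʳ v
    +-⨁-absorbs {v} {x ∷ xs} (x≈ ∷ xs≈) = begin
      v + (x + ⨁ xs) ≈⟨ +-assoc v x (⨁ xs) ⟨
      (v + x) + ⨁ xs ≈⟨ +-congʳ (+-absorbs-ZeroOr x≈) ⟩
      v + ⨁ xs       ≈⟨ +-⨁-absorbs xs≈ ⟩
      v              ∎

    ⨁-zeros : ∀ {xs} → All (_≈ 0#) xs → ⨁ xs ≈ 0#
    ⨁-zeros xs≈0 = trans (sym (+-identityˡ _)) (+-⨁-absorbs (All.map inj₁ xs≈0))

    ⨁-attained : ∀ {v xs} → All (ZeroOr v) xs → Any (_≈ v) xs → ⨁ xs ≈ v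
    ⨁-attained (_ ∷ xs≈) (here x≈v) = trans (+-congʳ x≈v) (+-⨁-absorbs xs≈)
    ⨁-attained (x≈ ∷ xs≈) (there v∈xs) =
      trans (+-congˡ (⨁-attained xs≈ v∈xs)) (trans (+-comm _ _) (+-absorbs-ZeroOr x≈))

    ⨁-concentrated : ∀ {n} (f : Subset n → K) (e : Subset n) →
                     (∀ b → b ≢ e → f b ≈ 0#) → ⨁ (map f (allSubsets n)) ≈ f e
    ⨁-concentrated {n} f e vanishes =
      ⨁-attained (All.map⁺ (All.universal zeroOrAt (allSubsets n)))
                 (Any.map⁺ (lose (∈-allSubsets e) refl))
      where
      zeroOrAt : ∀ b → ZeroOr (f e) (f b)
      zeroOrAt b with ≡-dec _≟ᵇ_ b e
      ... | yes ≡.refl = inj₂ refl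
      ... | no b≢e = inj₁ (vanishes b b≢e)

    sumOver-⟦⟧ : ∀ {n} (a : Subset n) (f : Subset n → K) → sumOver ⟦ a ⟧ f ≈ f a
    sumOver-⟦⟧ a f = begin
      ⨁ (map (λ b → if ⟦ a ⟧ b then f b else 0#) (allSubsets _))
        ≈⟨ ⨁-concentrated _ a (λ b b≢a → if-false (f b) (≟ˢ-≢ b≢a)) ⟩
      (if ⟦ a ⟧ a then f a else 0#)
        ≡⟨ ≡.cong (λ t → if t then f a else 0#) (≟ˢ-refl a) ⟩
      f a ∎

    sumOver-indicator : ∀ {n} (γ : Γ n) (e : Subset n) x →
                        sumOver γ (λ b → if ⟦ e ⟧ b then x else 0#) ≈ (if γ e then x else 0#)
    sumOver-indicator γ e x = begin
      ⨁ (map (λ b → if γ b then (if ⟦ e ⟧ b then x else 0#) else 0#) (allSubsets _))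
        ≈⟨ ⨁-concentrated _ e vanishes ⟩
      (if γ e then (if ⟦ e ⟧ e then x else 0#) else 0#)
        ≡⟨ ≡.cong (λ t → if γ e then (if t then x else 0#) else 0#) (≟ˢ-refl e) ⟩
      (if γ e then x else 0#) ∎
      where
      vanishes : ∀ b → b ≢ e → (if γ b then (if ⟦ e ⟧ b then x else 0#) else 0#) ≈ 0#
      vanishes b b≢e rewrite ≟ˢ-≢ b≢e = if-0# (γ b)

    ⨁-if-any : ∀ {A : Set} (γ t : A → Bool) x xs →
      ⨁ (map (λ a → if γ a then (if t a then x else 0#) else 0#) xs)
        ≈ (if foldr (λ a r → if γ a then (if t a then true else r) else r) false xs then x else 0#)
    ⨁-if-any γ t x [] = refl
    ⨁-if-any γ t x (a ∷ xs) with γ a | t a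
    ... | true  | true  = trans (+-congˡ (⨁-if-any γ t x xs)) (+-absorbs-ZeroOr (if-ZeroOr _ x))
    ... | true  | false = trans (+-identityˡ _) (⨁-if-any γ t x xs)
    ... | false | _     = trans (+-identityˡ _) (⨁-if-any γ t x xs)

    sumOver-anyIn : ∀ {n} (γ : Γ n) (t : Subset n → Bool) x →
                    sumOver γ (λ a → if t a then x else 0#) ≈ (if anyIn γ t then x else 0#)
    sumOver-anyIn {n} γ t x = ⨁-if-any γ t x (allSubsets n)

    sumOver-0# : ∀ {n} (γ : Γ n) → sumOver γ (λ _ → 0#) ≈ 0#
    sumOver-0# {n} γ = ⨁-zeros (All.map⁺ (All.universal (λ a → if-0# (γ a)) (allSubsets n)))

    ‖‖≈sumOver-density : ∀ {n} (z : Term n) k (γ : Γ n) → ‖ z ‖ k γ ≈ sumOver γ (density z k)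
    ‖‖≈sumOver-density 𝟘          k γ = sym (sumOver-0# γ)
    ‖‖≈sumOver-density 𝟙          k γ = sym (sumOver-indicator γ (replicate _ outside) 1#)
    ‖‖≈sumOver-density (port p)   k γ = sym (sumOver-anyIn γ (λ a → lookup a p) (k p))
    ‖‖≈sumOver-density (z₁ ⊕ z₂) k γ = refl
    ‖‖≈sumOver-density (z₁ ⊗ z₂) k γ = refl

    sumOver-‖‖-⟦⟧ : ∀ {n} (z : Term n) k (γ : Γ n) →
                   sumOver γ (λ a → ‖ z ‖ k ⟦ a ⟧) ≈ ‖ z ‖ k γ
    sumOver-‖‖-⟦⟧ z k γ = begin
      sumOver γ (λ a → ‖ z ‖ k ⟦ a ⟧)
        ≈⟨ sumOver-cong γ (λ a → trans (‖‖≈sumOver-density z k ⟦ a ⟧) (sumOver-⟦⟧ a (density z k))) ⟩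
      sumOver γ (density z k)
        ≈⟨ ‖‖≈sumOver-density z k γ ⟨
      ‖ z ‖ k γ ∎

lemma1 : {c ℓ : Level} (S : CommutativeSemiring c ℓ) →
    let open CommutativeSemiring S in
    (∀ x → (x + x) ≈ x) →
    (m : ℕ) → let n = suc m in
    (k : Fin n → Carrier) (z : Term n) (γ : Γ n) →
    Semantics.sumOver S γ (λ a → Semantics.‖_‖ S z k (⟦ a ⟧)) ≈ Semantics.‖_‖ S z k γ
lemma1 S +-idem m k z γ = Idempotent.sumOver-‖‖-⟦⟧ S +-idem z k γ
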